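{- Let $t\ge2$ and $n_1\ge n_2\ge\dots\ge n_t\ge1$ be integers, let $G=K_{n_1,\dots,n_t}$ be the complete $t$-partite graph with parts $V_i$, $|V_i|=n_i$, and $n=\sum_{i=1}^t n_i$. For an integer $0<a<n$, let $q$ be the index with $\sum_{i=1}^{q-1}n_i\le a<\sum_{i=1}^q n_i$. Then $$\min_{A\subseteq V(G),\,|A|=a} e(G[A])=\sum_{1\le i<j\le q-1}n_in_j+\Big(a-\sum_{i=1}^{q-1}n_i\Big)\sum_{i=1}^{q-1}n_i.$$
   Context: $e(G[A])$ denotes the number of edges of the subgraph of $G$ induced by $A$. -}

module Defs where

open import Data.Nat using (ℕ; zero; suc; _+_; _*_; _<?_)
open import Data.Fin as Fin using (Fin; toℕ; splitAt)
open import Data.Fin.Subset using (Subset; _∈_)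
open import Data.Fin.Subset.Properties using (_∈?_)
open import Data.Sum using (inj₁; inj₂)
open import Data.Product using (_×_; _,_)
open import Data.List using (List; length; filter; map; allFin; cartesianProduct)
open import Data.Nat.ListAction using (sum)
open import Relation.Nullary using (¬_; _×-dec_; ¬?)
open import Relation.Binary.PropositionalEquality using (_≡_)

-- Part sizes of K_{n_1,...,n_t}: a function  sz : Fin t → ℕ  (parts indexed 0..t-1).

order : (t : ℕ) → (Fin t → ℕ) → ℕ
order zero    sz = 0
order (suc t) sz = sz Fin.zero + order t (λ i → sz (Fin.suc i))

-- Vertices of K_{n_1,...,n_t} are Fin (order t sz); the first n_1 vertices form
-- part V_1, the next n_2 form V_2, etc.  partOf gives the part of each vertex.
partOf : (t : ℕ) (sz : Fin t → ℕ) → Fin (order t sz) → Fin t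
partOf zero    sz ()
partOf (suc t) sz v with splitAt (sz Fin.zero) v
... | inj₁ _ = Fin.zero
... | inj₂ w = Fin.suc (partOf t (λ i → sz (Fin.suc i)) w)

Adj : (t : ℕ) (sz : Fin t → ℕ) → Fin (order t sz) → Fin (order t sz) → Set
Adj t sz u v = ¬ (partOf t sz u ≡ partOf t sz v)

edgesIn : (t : ℕ) (sz : Fin t → ℕ) → Subset (order t sz) → ℕ
edgesIn t sz A =
  length (filter (λ { (u , v) → (u Fin.<? v) ×-dec ((u ∈? A) ×-dec ((v ∈? A)
                     ×-dec ¬? (partOf t sz u Fin.≟ partOf t sz v))) })
                 (cartesianProduct (allFin N) (allFin N)))
  where N = order t sz

prefixSum : (t : ℕ) → (Fin t → ℕ) → ℕ → ℕ
prefixSum t sz k = sum (map sz (filter (λ i → toℕ i <? k) (allFin t)))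

pairSum : (t : ℕ) → (Fin t → ℕ) → ℕ → ℕ
pairSum t sz k =
  sum (map (λ { (i , j) → sz i * sz j })
           (filter (λ { (i , j) → (toℕ i <? toℕ j) ×-dec (toℕ j <? k) })
                   (cartesianProduct (allFin t) (allFin t))))

-- Filling the parts greedily in the order V₁, V₂, … is optimal.  If g(a) is the
-- edge count of the greedy a-set, then g(a) = n₁ (a ∸ n₁) + g'(a ∸ n₁), with g' the
-- greedy count of the remaining parts.  Conversely, write A = A₁ ∪ A' with A₁ ⊆ V₁:
-- then e(A) = |A₁| |A'| + e(A') ≥ |A₁| |A'| + g'(|A'|) by induction, and since V₁ is
-- the largest part an exchange argument gives g(c + b) ≤ c b + g'(b) for c = |A₁|,
-- b = |A'|: if b ≤ n₂ this is n₁ (c + b ∸ n₁) ≤ c b, i.e. (n₁ − c)(n₁ − b) ≥ 0;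
-- otherwise V₂ is filled completely and exchanging the roles of V₁ and V₂ does not
-- increase the count.  Unfolding g for Σ_{i<q} nᵢ ≤ a < Σ_{i≤q} nᵢ gives the formula.
module Submission where

open import Defs
open import Data.Nat using (ℕ; zero; suc; _+_; _*_; _∸_; _⊓_; _≤_; _<_; z≤n; s≤s; s<s; s<s⁻¹; _≤?_)
import Data.Nat as ℕ
open import Data.Nat.Properties
open import Data.Nat.Tactic.RingSolver using (solve-∀)
open import Data.Fin using (Fin; toℕ; _↑ˡ_; _↑ʳ_)
import Data.Fin as Fin
import Data.Fin.Properties as Finₚ
open import Data.Fin.Subset using (Subset; ∣_∣; inside; outside; _∈_)
open import Data.Fin.Subset.Properties using (_∈?_; ∣p∣≤n)
open import Data.Product using (Σ; _×_; _,_)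
open import Data.List using (List; []; _∷_; map; filter; length; allFin; cartesianProduct; tabulate)
import Data.List as List
open import Data.List.Properties using (map-++; map-tabulate; map-∘)
open import Data.Nat.ListAction using (sum)
open import Data.Nat.ListAction.Properties using (sum-++)
open import Data.Vec using (_++_)
import Data.Vec as Vec
open import Data.Vec.Functional using () renaming (_∷_ to _◂_)
open import Algebra.Properties.Semiring.Sum +-*-semiring
  using (sum-syntax; sum-cong-≗; sum-replicate-zero; *-distribˡ-sum; *-distribʳ-sum)
open import Data.Bool using (if_then_else_)
open import Relation.Nullary using (Dec; does; yes; no; ¬_; _×-dec_; ¬?; contradiction)
open import Relation.Binary.PropositionalEquality
open import Function using (_∘_; id)

𝟙 : ∀ {p} {P : Set p} → Dec P → ℕ
𝟙 P? = if does P? then 1 else 0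

module _ {p q} {P : Set p} {Q : Set q} where

  𝟙-× : (P? : Dec P) (Q? : Dec Q) → 𝟙 (P? ×-dec Q?) ≡ 𝟙 P? * 𝟙 Q?
  𝟙-× (yes _) (yes _) = refl
  𝟙-× (yes _) (no _)  = refl
  𝟙-× (no _)  _       = refl

  𝟙-⇔ : (P → Q) → (Q → P) → (P? : Dec P) (Q? : Dec Q) → 𝟙 P? ≡ 𝟙 Q?
  𝟙-⇔ _ _ (yes _) (yes _) = refl
  𝟙-⇔ f _ (yes p) (no ¬q) = contradiction (f p) ¬q
  𝟙-⇔ _ g (no ¬p) (yes q) = contradiction (g q) ¬p
  𝟙-⇔ _ _ (no _)  (no _)  = refl

module _ {p} {P : Set p} where

  𝟙-yes : P → (P? : Dec P) → 𝟙 P? ≡ 1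
  𝟙-yes _ (yes _) = refl
  𝟙-yes p (no ¬p) = contradiction p ¬p

  𝟙-no : ¬ P → (P? : Dec P) → 𝟙 P? ≡ 0
  𝟙-no ¬p (yes p) = contradiction p ¬p
  𝟙-no _  (no _)  = refl

∑-zero : ∀ n {f : Fin n → ℕ} → (∀ i → f i ≡ 0) → ∑[ i < n ] f i ≡ 0
∑-zero n f≗0 = trans (sum-cong-≗ f≗0) (sum-replicate-zero n)

∑-↑ : ∀ m n (f : Fin (m + n) → ℕ) →
      ∑[ k < m + n ] f k ≡ ∑[ i < m ] f (i ↑ˡ n) + ∑[ j < n ] f (m ↑ʳ j)
∑-↑ zero    n f = refl
∑-↑ (suc m) n f = trans (cong (f Fin.zero +_) (∑-↑ m n (f ∘ Fin.suc))) (sym (+-assoc (f Fin.zero) _ _))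

sum-map-allFin : ∀ n (f : Fin n → ℕ) → sum (map f (allFin n)) ≡ ∑[ i < n ] f i
sum-map-allFin n f = trans (cong sum (map-tabulate id f)) (sum-tabulate n f)
  where
  sum-tabulate : ∀ n (f : Fin n → ℕ) → sum (tabulate f) ≡ ∑[ i < n ] f i
  sum-tabulate zero    f = refl
  sum-tabulate (suc n) f = cong (f Fin.zero +_) (sum-tabulate n (f ∘ Fin.suc))

module _ {a p} {A : Set a} {P : A → Set p} (P? : ∀ x → Dec (P x)) where

  length-filter-𝟙 : (xs : List A) → length (filter P? xs) ≡ sum (map (𝟙 ∘ P?) xs)
  length-filter-𝟙 []       = refl
  length-filter-𝟙 (x ∷ xs) with P? x
  ... | yes _ = cong suc (length-filter-𝟙 xs)
  ... | no _  = length-filter-𝟙 xs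

  sum-map-filter : (g : A → ℕ) (xs : List A) →
                   sum (map g (filter P? xs)) ≡ sum (map (λ x → 𝟙 (P? x) * g x) xs)
  sum-map-filter g []       = refl
  sum-map-filter g (x ∷ xs) with P? x
  ... | yes _ = cong₂ _+_ (sym (+-identityʳ (g x))) (sum-map-filter g xs)
  ... | no _  = sum-map-filter g xs

sum-map-cartesianProduct : ∀ m n (h : Fin m × Fin n → ℕ) →
  sum (map h (cartesianProduct (allFin m) (allFin n))) ≡ ∑[ i < m ] ∑[ j < n ] h (i , j)
sum-map-cartesianProduct m n h = begin
    sum (map h (cartesianProduct (allFin m) (allFin n)))
  ≡⟨ sum-map-product (allFin m) ⟩
    sum (map (λ i → sum (map (λ j → h (i , j)) (allFin n))) (allFin m))
  ≡⟨ sum-map-allFin m _ ⟩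
    ∑[ i < m ] sum (map (λ j → h (i , j)) (allFin n))
  ≡⟨ sum-cong-≗ (λ i → sum-map-allFin n (λ j → h (i , j))) ⟩
    ∑[ i < m ] ∑[ j < n ] h (i , j) ∎
  where
  open ≡-Reasoning
  sum-map-product : (xs : List (Fin m)) → sum (map h (cartesianProduct xs (allFin n)))
                  ≡ sum (map (λ i → sum (map (λ j → h (i , j)) (allFin n))) xs)
  sum-map-product []       = refl
  sum-map-product (i ∷ xs) = begin
      sum (map h (map (i ,_) (allFin n) List.++ cartesianProduct xs (allFin n)))
    ≡⟨ cong sum (map-++ h (map (i ,_) (allFin n)) _) ⟩
      sum (map h (map (i ,_) (allFin n)) List.++ map h (cartesianProduct xs (allFin n)))
    ≡⟨ sum-++ (map h (map (i ,_) (allFin n))) _ ⟩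
      sum (map h (map (i ,_) (allFin n))) + sum (map h (cartesianProduct xs (allFin n)))
    ≡⟨ cong₂ _+_ (cong sum (sym (map-∘ (allFin n)))) (sum-map-product xs) ⟩
      sum (map (λ j → h (i , j)) (allFin n)) + sum (map (λ i → sum (map (λ j → h (i , j)) (allFin n))) xs) ∎

↑ˡ<↑ʳ : ∀ {m n} (i : Fin m) (j : Fin n) → i ↑ˡ n Fin.< m ↑ʳ j
↑ˡ<↑ʳ {m} {n} i j = begin-strict
  toℕ (i ↑ˡ n)  ≡⟨ Finₚ.toℕ-↑ˡ i n ⟩
  toℕ i         <⟨ Finₚ.toℕ<n i ⟩
  m             ≤⟨ m≤m+n m (toℕ j) ⟩
  m + toℕ j     ≡⟨ Finₚ.toℕ-↑ʳ m j ⟨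
  toℕ (m ↑ʳ j)  ∎
  where open ≤-Reasoning

↑ʳ-mono-< : ∀ m {n} {i j : Fin n} → i Fin.< j → m ↑ʳ i Fin.< m ↑ʳ j
↑ʳ-mono-< m {i = i} {j} i<j =
  subst₂ _<_ (sym (Finₚ.toℕ-↑ʳ m i)) (sym (Finₚ.toℕ-↑ʳ m j)) (+-monoʳ-< m i<j)

↑ʳ-cancel-< : ∀ m {n} {i j : Fin n} → m ↑ʳ i Fin.< m ↑ʳ j → i Fin.< j
↑ʳ-cancel-< m {i = i} {j} i<j =
  +-cancelˡ-< m _ _ (subst₂ _<_ (Finₚ.toℕ-↑ʳ m i) (Finₚ.toℕ-↑ʳ m j) i<j)

∣p∣≡∑𝟙∈ : ∀ {n} (A : Subset n) → ∣ A ∣ ≡ ∑[ i < n ] 𝟙 (i ∈? A)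
∣p∣≡∑𝟙∈ Vec.[]            = refl
∣p∣≡∑𝟙∈ (inside  Vec.∷ A) = cong suc (∣p∣≡∑𝟙∈ A)
∣p∣≡∑𝟙∈ (outside Vec.∷ A) = ∣p∣≡∑𝟙∈ A

∣p++q∣ : ∀ {m n} (A : Subset m) (B : Subset n) → ∣ A ++ B ∣ ≡ ∣ A ∣ + ∣ B ∣
∣p++q∣ Vec.[]            B = refl
∣p++q∣ (inside  Vec.∷ A) B = cong suc (∣p++q∣ A B)
∣p++q∣ (outside Vec.∷ A) B = ∣p++q∣ A B

𝟙-∈-++ˡ : ∀ {m} n (A : Subset m) (B : Subset n) i → 𝟙 ((i ↑ˡ n) ∈? (A ++ B)) ≡ 𝟙 (i ∈? A)
𝟙-∈-++ˡ n (inside  Vec.∷ A) B Fin.zero    = refl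
𝟙-∈-++ˡ n (outside Vec.∷ A) B Fin.zero    = refl
𝟙-∈-++ˡ n (_       Vec.∷ A) B (Fin.suc i) = 𝟙-∈-++ˡ n A B i

𝟙-∈-++ʳ : ∀ {m n} (A : Subset m) (B : Subset n) j → 𝟙 ((m ↑ʳ j) ∈? (A ++ B)) ≡ 𝟙 (j ∈? B)
𝟙-∈-++ʳ Vec.[]          B j = refl
𝟙-∈-++ʳ (_ Vec.∷ A) B j = 𝟙-∈-++ʳ A B j

module _ (t : ℕ) (sz : Fin t → ℕ) (A : Subset (order t sz)) where

  edge? : (u v : Fin (order t sz)) →
          Dec (u Fin.< v × u ∈ A × v ∈ A × ¬ (partOf t sz u ≡ partOf t sz v))
  edge? u v = (u Fin.<? v) ×-dec ((u ∈? A) ×-dec ((v ∈? A) ×-dec ¬? (partOf t sz u Fin.≟ partOf t sz v)))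

  𝟙-edge? : ∀ u v → 𝟙 (edge? u v) ≡
            𝟙 (u Fin.<? v) * (𝟙 (u ∈? A) * (𝟙 (v ∈? A) * 𝟙 (¬? (partOf t sz u Fin.≟ partOf t sz v))))
  𝟙-edge? u v =
    trans (𝟙-× (u Fin.<? v) (u∈? ×-dec (v∈? ×-dec distinct?)))
          (cong (𝟙 (u Fin.<? v) *_) (trans (𝟙-× u∈? (v∈? ×-dec distinct?))
                                          (cong (𝟙 u∈? *_) (𝟙-× v∈? distinct?))))
    where
    u∈? = u ∈? A
    v∈? = v ∈? A
    distinct? = ¬? (partOf t sz u Fin.≟ partOf t sz v)

  edgesIn≡∑∑𝟙edge? : edgesIn t sz A ≡ ∑[ u < order t sz ] ∑[ v < order t sz ] 𝟙 (edge? u v)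
  edgesIn≡∑∑𝟙edge? = trans (length-filter-𝟙 _ (cartesianProduct (allFin N) (allFin N)))
                            (sum-map-cartesianProduct N N _)
    where N = order t sz

module _ (t : ℕ) (sz : Fin (suc t) → ℕ) where

  private
    n₁  = sz Fin.zero
    sz' = sz ∘ Fin.suc
    N   = order t sz'

  partOf-↑ˡ : ∀ i → partOf (suc t) sz (i ↑ˡ N) ≡ Fin.zero
  partOf-↑ˡ i rewrite Finₚ.splitAt-↑ˡ n₁ i N = refl

  partOf-↑ʳ : ∀ j → partOf (suc t) sz (n₁ ↑ʳ j) ≡ Fin.suc (partOf t sz' j)
  partOf-↑ʳ j rewrite Finₚ.splitAt-↑ʳ n₁ N j = refl

  module _ (A₀ : Subset n₁) (A' : Subset N) where

    private
      A = A₀ ++ A'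
      edge?ᴬ = edge? (suc t) sz A

    𝟙-edge?-↑ˡ-↑ˡ : ∀ i j → 𝟙 (edge?ᴬ (i ↑ˡ N) (j ↑ˡ N)) ≡ 0
    𝟙-edge?-↑ˡ-↑ˡ i j = 𝟙-no (λ { (_ , _ , _ , ≢) → ≢ (trans (partOf-↑ˡ i) (sym (partOf-↑ˡ j))) })
                                (edge?ᴬ (i ↑ˡ N) (j ↑ˡ N))

    𝟙-edge?-↑ʳ-↑ˡ : ∀ i j → 𝟙 (edge?ᴬ (n₁ ↑ʳ i) (j ↑ˡ N)) ≡ 0
    𝟙-edge?-↑ʳ-↑ˡ i j = 𝟙-no (λ { (i<j , _) → <-asym i<j (↑ˡ<↑ʳ j i) }) (edge?ᴬ (n₁ ↑ʳ i) (j ↑ˡ N))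

    𝟙-edge?-↑ˡ-↑ʳ : ∀ i j → 𝟙 (edge?ᴬ (i ↑ˡ N) (n₁ ↑ʳ j)) ≡ 𝟙 (i ∈? A₀) * 𝟙 (j ∈? A')
    𝟙-edge?-↑ˡ-↑ʳ i j = begin
        𝟙 (edge?ᴬ (i ↑ˡ N) (n₁ ↑ʳ j))
      ≡⟨ 𝟙-edge? (suc t) sz A (i ↑ˡ N) (n₁ ↑ʳ j) ⟩
        𝟙 ((i ↑ˡ N) Fin.<? (n₁ ↑ʳ j)) * (𝟙 ((i ↑ˡ N) ∈? A) * (𝟙 ((n₁ ↑ʳ j) ∈? A) * 𝟙 distinct?))
      ≡⟨ cong₂ _*_ (𝟙-yes (↑ˡ<↑ʳ i j) ((i ↑ˡ N) Fin.<? (n₁ ↑ʳ j)))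
                   (cong₂ _*_ (𝟙-∈-++ˡ N A₀ A' i) (cong₂ _*_ (𝟙-∈-++ʳ A₀ A' j) (𝟙-yes distinct distinct?))) ⟩
        1 * (𝟙 (i ∈? A₀) * (𝟙 (j ∈? A') * 1))
      ≡⟨ trans (*-identityˡ _) (cong (𝟙 (i ∈? A₀) *_) (*-identityʳ _)) ⟩
        𝟙 (i ∈? A₀) * 𝟙 (j ∈? A') ∎
      where
      open ≡-Reasoning
      distinct? = ¬? (partOf (suc t) sz (i ↑ˡ N) Fin.≟ partOf (suc t) sz (n₁ ↑ʳ j))
      distinct : ¬ (partOf (suc t) sz (i ↑ˡ N) ≡ partOf (suc t) sz (n₁ ↑ʳ j))
      distinct eq with () ← trans (sym (partOf-↑ˡ i)) (trans eq (partOf-↑ʳ j))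

    𝟙-edge?-↑ʳ-↑ʳ : ∀ i j → 𝟙 (edge?ᴬ (n₁ ↑ʳ i) (n₁ ↑ʳ j)) ≡ 𝟙 (edge? t sz' A' i j)
    𝟙-edge?-↑ʳ-↑ʳ i j = begin
        𝟙 (edge?ᴬ (n₁ ↑ʳ i) (n₁ ↑ʳ j))
      ≡⟨ 𝟙-edge? (suc t) sz A (n₁ ↑ʳ i) (n₁ ↑ʳ j) ⟩
        𝟙 ((n₁ ↑ʳ i) Fin.<? (n₁ ↑ʳ j)) * (𝟙 ((n₁ ↑ʳ i) ∈? A) * (𝟙 ((n₁ ↑ʳ j) ∈? A) * 𝟙 distinct?))
      ≡⟨ cong₂ _*_ (𝟙-⇔ (↑ʳ-cancel-< n₁) (↑ʳ-mono-< n₁) ((n₁ ↑ʳ i) Fin.<? (n₁ ↑ʳ j)) (i Fin.<? j))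
                   (cong₂ _*_ (𝟙-∈-++ʳ A₀ A' i)
                              (cong₂ _*_ (𝟙-∈-++ʳ A₀ A' j)
                                         (𝟙-⇔ (_∘ cong-partOf) (_∘ partOf-injective) distinct? distinct'?))) ⟩
        𝟙 (i Fin.<? j) * (𝟙 (i ∈? A') * (𝟙 (j ∈? A') * 𝟙 distinct'?))
      ≡⟨ 𝟙-edge? t sz' A' i j ⟨
        𝟙 (edge? t sz' A' i j) ∎
      where
      open ≡-Reasoning
      distinct? = ¬? (partOf (suc t) sz (n₁ ↑ʳ i) Fin.≟ partOf (suc t) sz (n₁ ↑ʳ j))
      distinct'? = ¬? (partOf t sz' i Fin.≟ partOf t sz' j)
      cong-partOf : partOf t sz' i ≡ partOf t sz' j →
                    partOf (suc t) sz (n₁ ↑ʳ i) ≡ partOf (suc t) sz (n₁ ↑ʳ j)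
      cong-partOf eq = trans (partOf-↑ʳ i) (trans (cong Fin.suc eq) (sym (partOf-↑ʳ j)))
      partOf-injective : partOf (suc t) sz (n₁ ↑ʳ i) ≡ partOf (suc t) sz (n₁ ↑ʳ j) →
                         partOf t sz' i ≡ partOf t sz' j
      partOf-injective eq = Finₚ.suc-injective (trans (sym (partOf-↑ʳ i)) (trans eq (partOf-↑ʳ j)))

    edgesIn-++ : edgesIn (suc t) sz (A₀ ++ A') ≡ ∣ A₀ ∣ * ∣ A' ∣ + edgesIn t sz' A'
    edgesIn-++ = begin
        edgesIn (suc t) sz A
      ≡⟨ edgesIn≡∑∑𝟙edge? (suc t) sz A ⟩
        ∑[ u < n₁ + N ] ∑[ v < n₁ + N ] 𝟙 (edge?ᴬ u v)
      ≡⟨ ∑-↑ n₁ N _ ⟩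
        ∑[ i < n₁ ] ∑[ v < n₁ + N ] 𝟙 (edge?ᴬ (i ↑ˡ N) v)
          + ∑[ i < N ] ∑[ v < n₁ + N ] 𝟙 (edge?ᴬ (n₁ ↑ʳ i) v)
      ≡⟨ cong₂ _+_ (sum-cong-≗ row-↑ˡ) (sum-cong-≗ row-↑ʳ) ⟩
        ∑[ i < n₁ ] ∑[ j < N ] (𝟙 (i ∈? A₀) * 𝟙 (j ∈? A'))
          + ∑[ i < N ] ∑[ j < N ] 𝟙 (edge? t sz' A' i j)
      ≡⟨ cong₂ _+_ (trans (sum-cong-≗ λ i → sym (*-distribˡ-sum (𝟙 (i ∈? A₀)) (λ j → 𝟙 (j ∈? A'))))
                          (sym (*-distribʳ-sum (∑[ j < N ] 𝟙 (j ∈? A')) (λ i → 𝟙 (i ∈? A₀)))))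
                   (sym (edgesIn≡∑∑𝟙edge? t sz' A')) ⟩
        (∑[ i < n₁ ] 𝟙 (i ∈? A₀)) * (∑[ j < N ] 𝟙 (j ∈? A')) + edgesIn t sz' A'
      ≡⟨ cong (_+ edgesIn t sz' A') (cong₂ _*_ (∣p∣≡∑𝟙∈ A₀) (∣p∣≡∑𝟙∈ A')) ⟨
        ∣ A₀ ∣ * ∣ A' ∣ + edgesIn t sz' A' ∎
      where
      open ≡-Reasoning
      row-↑ˡ : ∀ i → ∑[ v < n₁ + N ] 𝟙 (edge?ᴬ (i ↑ˡ N) v) ≡ ∑[ j < N ] (𝟙 (i ∈? A₀) * 𝟙 (j ∈? A'))
      row-↑ˡ i = trans (∑-↑ n₁ N _) (cong₂ _+_ (∑-zero n₁ (𝟙-edge?-↑ˡ-↑ˡ i)) (sum-cong-≗ (𝟙-edge?-↑ˡ-↑ʳ i)))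
      row-↑ʳ : ∀ i → ∑[ v < n₁ + N ] 𝟙 (edge?ᴬ (n₁ ↑ʳ i) v) ≡ ∑[ j < N ] 𝟙 (edge? t sz' A' i j)
      row-↑ʳ i = trans (∑-↑ n₁ N _) (cong₂ _+_ (∑-zero n₁ (𝟙-edge?-↑ʳ-↑ˡ i)) (sum-cong-≗ (𝟙-edge?-↑ʳ-↑ʳ i)))

m*[c+b∸m]≤c*b : ∀ {m c b} → c ≤ m → b ≤ m → m * (c + b ∸ m) ≤ c * b
m*[c+b∸m]≤c*b {m} {c} {b} c≤m b≤m with c + b ≤? m
... | yes c+b≤m = ≤-trans (≤-reflexive (trans (cong (m *_) (m≤n⇒m∸n≡0 c+b≤m)) (*-zeroʳ m))) z≤n
... | no  c+b≰m with m≤n⇒∃[o]m+o≡n b≤m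
... | d , refl with m≤n⇒∃[o]m+o≡n d≤c
  where
  d≤c : d ≤ c
  d≤c = +-cancelˡ-≤ b d c (subst (b + d ≤_) (+-comm c b) (<⇒≤ (≰⇒> c+b≰m)))
... | y , refl = begin
    (b + d) * ((d + y) + b ∸ (b + d))
  ≡⟨ cong (λ z → (b + d) * (z ∸ (b + d))) (trans (+-comm (d + y) b) (sym (+-assoc b d y))) ⟩
    (b + d) * ((b + d) + y ∸ (b + d))
  ≡⟨ cong ((b + d) *_) (m+n∸m≡n (b + d) y) ⟩
    (b + d) * y
  ≡⟨ *-distribʳ-+ y b d ⟩
    b * y + d * y
  ≤⟨ +-monoʳ-≤ (b * y) (*-monoʳ-≤ d y≤b) ⟩
    b * y + d * b
  ≡⟨ rearrange b d y ⟩
    (d + y) * b ∎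
  where
  open ≤-Reasoning
  y≤b : y ≤ b
  y≤b = +-cancelˡ-≤ d y b (subst (d + y ≤_) (+-comm b d) c≤m)
  rearrange : ∀ b d y → b * y + d * b ≡ (d + y) * b
  rearrange = solve-∀

m+[n+o]≡n+[m+o] : ∀ m n o → m + (n + o) ≡ n + (m + o)
m+[n+o]≡n+[m+o] = solve-∀

[m⊓n]*[n∸m]≡m*[n∸m] : ∀ m n → (m ⊓ n) * (n ∸ m) ≡ m * (n ∸ m)
[m⊓n]*[n∸m]≡m*[n∸m] m n with m ≤? n
... | yes m≤n = cong (_* (n ∸ m)) (m≤n⇒m⊓n≡m m≤n)
... | no  m≰n rewrite m≤n⇒m∸n≡0 (<⇒≤ (≰⇒> m≰n)) = trans (*-zeroʳ (m ⊓ n)) (sym (*-zeroʳ m))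

-- The min(a, n₁) vertices taken from V₁ are adjacent to the a ∸ n₁ taken later,
-- and min(a, n₁) · (a ∸ n₁) = n₁ · (a ∸ n₁).
greedyEdges : (t : ℕ) → (Fin t → ℕ) → ℕ → ℕ
greedyEdges zero    sz a = 0
greedyEdges (suc t) sz a = sz Fin.zero * (a ∸ sz Fin.zero) + greedyEdges t (sz ∘ Fin.suc) (a ∸ sz Fin.zero)

greedyEdges-zero : ∀ t sz → greedyEdges t sz 0 ≡ 0
greedyEdges-zero zero    sz = refl
greedyEdges-zero (suc t) sz
  rewrite 0∸n≡0 (sz Fin.zero) = cong₂ _+_ (*-zeroʳ (sz Fin.zero)) (greedyEdges-zero t (sz ∘ Fin.suc))

a≤n₁⇒greedyEdges≡0 : ∀ t sz {a} → a ≤ sz Fin.zero → greedyEdges (suc t) sz a ≡ 0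
a≤n₁⇒greedyEdges≡0 t sz a≤n₁
  rewrite m≤n⇒m∸n≡0 a≤n₁ = cong₂ _+_ (*-zeroʳ (sz Fin.zero)) (greedyEdges-zero t (sz ∘ Fin.suc))

greedyEdges-+ : ∀ t sz b → greedyEdges (suc t) sz (sz Fin.zero + b)
                         ≡ sz Fin.zero * b + greedyEdges t (sz ∘ Fin.suc) b
greedyEdges-+ t sz b rewrite m+n∸m≡n (sz Fin.zero) b = refl

greedyEdges-fill-second-≤ : ∀ t m (f : Fin (suc t) → ℕ) x → f Fin.zero ≤ m →
  greedyEdges (2 + t) (m ◂ f) (f Fin.zero + x) ≤ f Fin.zero * x + greedyEdges (suc t) (m ◂ (f ∘ Fin.suc)) x
greedyEdges-fill-second-≤ t m f x n₁≤m with x ≤? m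
... | yes x≤m = begin
    m * y + greedyEdges (suc t) f y
  ≡⟨ cong (m * y +_) (a≤n₁⇒greedyEdges≡0 t f y≤n₁) ⟩
    m * y + 0
  ≡⟨ +-identityʳ (m * y) ⟩
    m * y
  ≤⟨ m*[c+b∸m]≤c*b n₁≤m x≤m ⟩
    n₁ * x
  ≤⟨ m≤m+n (n₁ * x) _ ⟩
    n₁ * x + greedyEdges (suc t) (m ◂ f') x ∎
  where
  open ≤-Reasoning
  n₁ = f Fin.zero
  f' = f ∘ Fin.suc
  y = n₁ + x ∸ m
  y≤n₁ : y ≤ n₁
  y≤n₁ = ≤-trans (∸-monoˡ-≤ m (+-monoʳ-≤ n₁ x≤m)) (≤-reflexive (m+n∸n≡m n₁ m))
... | no x≰m with m≤n⇒∃[o]m+o≡n (<⇒≤ (≰⇒> x≰m))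
... | z , refl = ≤-reflexive (begin
    m * (n₁ + (m + z) ∸ m) + greedyEdges (suc t) f (n₁ + (m + z) ∸ m)
  ≡⟨ cong (λ w → m * w + greedyEdges (suc t) f w) n₁+[m+z]∸m≡n₁+z ⟩
    m * (n₁ + z) + greedyEdges (suc t) f (n₁ + z)
  ≡⟨ cong (m * (n₁ + z) +_) (greedyEdges-+ t f z) ⟩
    m * (n₁ + z) + (n₁ * z + greedyEdges t f' z)
  ≡⟨ rearrange m n₁ z (greedyEdges t f' z) ⟩
    n₁ * (m + z) + (m * z + greedyEdges t f' z)
  ≡⟨ cong (n₁ * (m + z) +_) (greedyEdges-+ t (m ◂ f') z) ⟨
    n₁ * (m + z) + greedyEdges (suc t) (m ◂ f') (m + z) ∎)
  where
  open ≡-Reasoning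
  n₁ = f Fin.zero
  f' = f ∘ Fin.suc
  n₁+[m+z]∸m≡n₁+z : n₁ + (m + z) ∸ m ≡ n₁ + z
  n₁+[m+z]∸m≡n₁+z = trans (cong (_∸ m) (m+[n+o]≡n+[m+o] n₁ m z)) (m+n∸m≡n m (n₁ + z))
  rearrange : ∀ m n₁ z g → m * (n₁ + z) + (n₁ * z + g) ≡ n₁ * (m + z) + (m * z + g)
  rearrange = solve-∀

greedyEdges-◂-≤ : ∀ t m (f : Fin t → ℕ) c b → (∀ i → f i ≤ m) → c ≤ m → b ≤ order t f →
                  greedyEdges (suc t) (m ◂ f) (c + b) ≤ c * b + greedyEdges t f b
greedyEdges-◂-≤ zero m f c .0 _ c≤m z≤n
  rewrite +-identityʳ c | m≤n⇒m∸n≡0 c≤m | *-zeroʳ m = z≤n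
greedyEdges-◂-≤ (suc t) m f c b f≤m c≤m b≤n with b ≤? f Fin.zero
... | yes b≤n₁ = begin
    m * y + greedyEdges (suc t) f y
  ≡⟨ cong (m * y +_) (a≤n₁⇒greedyEdges≡0 t f (≤-trans y≤b b≤n₁)) ⟩
    m * y + 0
  ≡⟨ +-identityʳ (m * y) ⟩
    m * y
  ≤⟨ m*[c+b∸m]≤c*b c≤m (≤-trans b≤n₁ (f≤m Fin.zero)) ⟩
    c * b
  ≤⟨ m≤m+n (c * b) _ ⟩
    c * b + greedyEdges (suc t) f b ∎
  where
  open ≤-Reasoning
  y = c + b ∸ m
  y≤b : y ≤ b
  y≤b = ≤-trans (∸-monoˡ-≤ m (+-monoˡ-≤ b c≤m)) (≤-reflexive (m+n∸m≡n m b))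
... | no b≰n₁ with m≤n⇒∃[o]m+o≡n (<⇒≤ (≰⇒> b≰n₁))
... | b' , refl = begin
    greedyEdges (2 + t) (m ◂ f) (c + (n₁ + b'))
  ≡⟨ cong (greedyEdges (2 + t) (m ◂ f)) (m+[n+o]≡n+[m+o] c n₁ b') ⟩
    greedyEdges (2 + t) (m ◂ f) (n₁ + (c + b'))
  ≤⟨ greedyEdges-fill-second-≤ t m f (c + b') (f≤m Fin.zero) ⟩
    n₁ * (c + b') + greedyEdges (suc t) (m ◂ f') (c + b')
  ≤⟨ +-monoʳ-≤ (n₁ * (c + b'))
       (greedyEdges-◂-≤ t m f' c b' (f≤m ∘ Fin.suc) c≤m (+-cancelˡ-≤ n₁ b' _ b≤n)) ⟩
    n₁ * (c + b') + (c * b' + greedyEdges t f' b')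
  ≡⟨ rearrange n₁ c b' (greedyEdges t f' b') ⟩
    c * (n₁ + b') + (n₁ * b' + greedyEdges t f' b')
  ≡⟨ cong (c * (n₁ + b') +_) (greedyEdges-+ t f b') ⟨
    c * (n₁ + b') + greedyEdges (suc t) f (n₁ + b') ∎
  where
  open ≤-Reasoning
  n₁ = f Fin.zero
  f' = f ∘ Fin.suc
  rearrange : ∀ n₁ c b' g → n₁ * (c + b') + (c * b' + g) ≡ c * (n₁ + b') + (n₁ * b' + g)
  rearrange = solve-∀

greedyEdges-≤-edgesIn : ∀ t (sz : Fin t → ℕ) → (∀ i j → toℕ i ≤ toℕ j → sz j ≤ sz i) →
                        (A : Subset (order t sz)) → greedyEdges t sz ∣ A ∣ ≤ edgesIn t sz A
greedyEdges-≤-edgesIn zero    sz antitone A = z≤n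
greedyEdges-≤-edgesIn (suc t) sz antitone A with Vec.splitAt (sz Fin.zero) A
... | A₀ , A' , refl = begin
    greedyEdges (suc t) sz ∣ A₀ ++ A' ∣
  ≡⟨ cong (greedyEdges (suc t) sz) (∣p++q∣ A₀ A') ⟩
    greedyEdges (suc t) sz (∣ A₀ ∣ + ∣ A' ∣)
  ≤⟨ greedyEdges-◂-≤ t (sz Fin.zero) (sz ∘ Fin.suc) ∣ A₀ ∣ ∣ A' ∣
       (λ i → antitone Fin.zero (Fin.suc i) z≤n) (∣p∣≤n A₀) (∣p∣≤n A') ⟩
    ∣ A₀ ∣ * ∣ A' ∣ + greedyEdges t (sz ∘ Fin.suc) ∣ A' ∣
  ≤⟨ +-monoʳ-≤ (∣ A₀ ∣ * ∣ A' ∣)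
       (greedyEdges-≤-edgesIn t (sz ∘ Fin.suc) (λ i j i≤j → antitone (Fin.suc i) (Fin.suc j) (s≤s i≤j)) A') ⟩
    ∣ A₀ ∣ * ∣ A' ∣ + edgesIn t (sz ∘ Fin.suc) A'
  ≡⟨ edgesIn-++ t sz A₀ A' ⟨
    edgesIn (suc t) sz (A₀ ++ A') ∎
  where open ≤-Reasoning

firstOf : (a s : ℕ) → Subset s
firstOf a       zero    = Vec.[]
firstOf zero    (suc s) = outside Vec.∷ firstOf zero s
firstOf (suc a) (suc s) = inside Vec.∷ firstOf a s

∣firstOf∣ : ∀ a s → ∣ firstOf a s ∣ ≡ s ⊓ a
∣firstOf∣ a       zero    = refl
∣firstOf∣ zero    (suc s) = trans (∣firstOf∣ zero s) (⊓-zeroʳ s)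
∣firstOf∣ (suc a) (suc s) = cong suc (∣firstOf∣ a s)

greedySubset : (t : ℕ) (sz : Fin t → ℕ) → ℕ → Subset (order t sz)
greedySubset zero    sz a = Vec.[]
greedySubset (suc t) sz a = firstOf a (sz Fin.zero) ++ greedySubset t (sz ∘ Fin.suc) (a ∸ sz Fin.zero)

∣greedySubset∣ : ∀ t (sz : Fin t → ℕ) {a} → a ≤ order t sz → ∣ greedySubset t sz a ∣ ≡ a
∣greedySubset∣ zero    sz z≤n = refl
∣greedySubset∣ (suc t) sz {a} a≤n = begin
    ∣ firstOf a n₁ ++ greedySubset t (sz ∘ Fin.suc) (a ∸ n₁) ∣
  ≡⟨ ∣p++q∣ (firstOf a n₁) _ ⟩
    ∣ firstOf a n₁ ∣ + ∣ greedySubset t (sz ∘ Fin.suc) (a ∸ n₁) ∣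
  ≡⟨ cong₂ _+_ (∣firstOf∣ a n₁) (∣greedySubset∣ t (sz ∘ Fin.suc) (m≤n+o⇒m∸n≤o a n₁ a≤n)) ⟩
    n₁ ⊓ a + (a ∸ n₁)
  ≡⟨ m⊓n+n∸m≡n n₁ a ⟩
    a ∎
  where
  open ≡-Reasoning
  n₁ = sz Fin.zero

edgesIn-greedySubset : ∀ t (sz : Fin t → ℕ) {a} → a ≤ order t sz →
                       edgesIn t sz (greedySubset t sz a) ≡ greedyEdges t sz a
edgesIn-greedySubset zero    sz z≤n = refl
edgesIn-greedySubset (suc t) sz {a} a≤n = begin
    edgesIn (suc t) sz (firstOf a n₁ ++ greedySubset t sz' (a ∸ n₁))
  ≡⟨ edgesIn-++ t sz (firstOf a n₁) _ ⟩
    ∣ firstOf a n₁ ∣ * ∣ greedySubset t sz' (a ∸ n₁) ∣ + edgesIn t sz' (greedySubset t sz' (a ∸ n₁))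
  ≡⟨ cong₂ _+_ (cong₂ _*_ (∣firstOf∣ a n₁) (∣greedySubset∣ t sz' a∸n₁≤))
               (edgesIn-greedySubset t sz' a∸n₁≤) ⟩
    (n₁ ⊓ a) * (a ∸ n₁) + greedyEdges t sz' (a ∸ n₁)
  ≡⟨ cong (_+ greedyEdges t sz' (a ∸ n₁)) ([m⊓n]*[n∸m]≡m*[n∸m] n₁ a) ⟩
    greedyEdges (suc t) sz a ∎
  where
  open ≡-Reasoning
  n₁ = sz Fin.zero
  sz' = sz ∘ Fin.suc
  a∸n₁≤ = m≤n+o⇒m∸n≤o a n₁ a≤n

module _ (t : ℕ) (sz : Fin t → ℕ) (k : ℕ) where

  prefixSum≡∑ : prefixSum t sz k ≡ ∑[ i < t ] (𝟙 (toℕ i ℕ.<? k) * sz i)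
  prefixSum≡∑ = trans (sum-map-filter (λ i → toℕ i ℕ.<? k) sz (allFin t)) (sum-map-allFin t _)

  pairSum≡∑∑ : pairSum t sz k
             ≡ ∑[ i < t ] ∑[ j < t ] (𝟙 ((toℕ i ℕ.<? toℕ j) ×-dec (toℕ j ℕ.<? k)) * (sz i * sz j))
  pairSum≡∑∑ = trans (sum-map-filter _ _ (cartesianProduct (allFin t) (allFin t))) (sum-map-cartesianProduct t t _)

prefixSum-zero : ∀ t sz → prefixSum t sz 0 ≡ 0
prefixSum-zero t sz = trans (prefixSum≡∑ t sz 0) (∑-zero t λ i → cong (_* sz i) (𝟙-no (λ ()) (toℕ i ℕ.<? 0)))

prefixSum-suc : ∀ t sz k → prefixSum (suc t) sz (suc k) ≡ sz Fin.zero + prefixSum t (sz ∘ Fin.suc) k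
prefixSum-suc t sz k = begin
    prefixSum (suc t) sz (suc k)
  ≡⟨ prefixSum≡∑ (suc t) sz (suc k) ⟩
    𝟙 (0 ℕ.<? suc k) * sz Fin.zero + ∑[ i < t ] (𝟙 (suc (toℕ i) ℕ.<? suc k) * sz (Fin.suc i))
  ≡⟨ cong₂ _+_ (trans (cong (_* sz Fin.zero) (𝟙-yes (s≤s z≤n) (0 ℕ.<? suc k))) (*-identityˡ _))
               (sum-cong-≗ λ i → cong (_* sz (Fin.suc i))
                 (𝟙-⇔ s<s⁻¹ s<s (suc (toℕ i) ℕ.<? suc k) (toℕ i ℕ.<? k))) ⟩
    sz Fin.zero + ∑[ i < t ] (𝟙 (toℕ i ℕ.<? k) * sz (Fin.suc i))
  ≡⟨ cong (sz Fin.zero +_) (prefixSum≡∑ t (sz ∘ Fin.suc) k) ⟨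
    sz Fin.zero + prefixSum t (sz ∘ Fin.suc) k ∎
  where open ≡-Reasoning

pairSum-zero : ∀ t sz → pairSum t sz 0 ≡ 0
pairSum-zero t sz = trans (pairSum≡∑∑ t sz 0) (∑-zero t λ i → ∑-zero t λ j →
  cong (_* (sz i * sz j)) (𝟙-no (λ { (_ , ()) }) ((toℕ i ℕ.<? toℕ j) ×-dec (toℕ j ℕ.<? 0))))

pairSum-suc : ∀ t sz k → pairSum (suc t) sz (suc k)
                       ≡ sz Fin.zero * prefixSum t (sz ∘ Fin.suc) k + pairSum t (sz ∘ Fin.suc) k
pairSum-suc t sz k = trans (pairSum≡∑∑ (suc t) sz (suc k)) (cong₂ _+_ firstRow otherRows)
  where
  open ≡-Reasoning
  n₁  = sz Fin.zero
  sz' = sz ∘ Fin.suc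
  ordered? : ∀ {t} k (i j : Fin t) → Dec (toℕ i < toℕ j × toℕ j < k)
  ordered? k i j = (toℕ i ℕ.<? toℕ j) ×-dec (toℕ j ℕ.<? k)

  firstRow : ∑[ j < suc t ] (𝟙 (ordered? (suc k) Fin.zero j) * (n₁ * sz j)) ≡ n₁ * prefixSum t sz' k
  firstRow = begin
      𝟙 (ordered? {suc t} (suc k) Fin.zero Fin.zero) * (n₁ * n₁)
        + ∑[ j < t ] (𝟙 (ordered? (suc k) Fin.zero (Fin.suc j)) * (n₁ * sz' j))
    ≡⟨ cong₂ _+_ (cong (_* (n₁ * n₁)) (𝟙-no (λ { (() , _) }) (ordered? {suc t} (suc k) Fin.zero Fin.zero)))
                 (sum-cong-≗ λ j → cong (_* (n₁ * sz' j))
                   (𝟙-⇔ (λ { (_ , j<k) → s<s⁻¹ j<k }) (λ j<k → s≤s z≤n , s<s j<k)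
                        (ordered? (suc k) Fin.zero (Fin.suc j)) (toℕ j ℕ.<? k))) ⟩
      ∑[ j < t ] (𝟙 (toℕ j ℕ.<? k) * (n₁ * sz' j))
    ≡⟨ sum-cong-≗ (λ j → *-comm-middle (𝟙 (toℕ j ℕ.<? k)) n₁ (sz' j)) ⟩
      ∑[ j < t ] (n₁ * (𝟙 (toℕ j ℕ.<? k) * sz' j))
    ≡⟨ *-distribˡ-sum n₁ (λ j → 𝟙 (toℕ j ℕ.<? k) * sz' j) ⟨
      n₁ * ∑[ j < t ] (𝟙 (toℕ j ℕ.<? k) * sz' j)
    ≡⟨ cong (n₁ *_) (prefixSum≡∑ t sz' k) ⟨
      n₁ * prefixSum t sz' k ∎
    where
    *-comm-middle : ∀ a b c → a * (b * c) ≡ b * (a * c)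
    *-comm-middle = solve-∀

  otherRows : ∑[ i < t ] ∑[ j < suc t ] (𝟙 (ordered? (suc k) (Fin.suc i) j) * (sz' i * sz j)) ≡ pairSum t sz' k
  otherRows = begin
      ∑[ i < t ] (𝟙 (ordered? (suc k) (Fin.suc i) Fin.zero) * (sz' i * n₁)
                  + ∑[ j < t ] (𝟙 (ordered? (suc k) (Fin.suc i) (Fin.suc j)) * (sz' i * sz' j)))
    ≡⟨ sum-cong-≗ (λ i → cong₂ _+_
         (cong (_* (sz' i * n₁)) (𝟙-no (λ { (() , _) }) (ordered? (suc k) (Fin.suc i) Fin.zero)))
         (sum-cong-≗ λ j → cong (_* (sz' i * sz' j))
           (𝟙-⇔ (λ { (i<j , j<k) → s<s⁻¹ i<j , s<s⁻¹ j<k }) (λ { (i<j , j<k) → s<s i<j , s<s j<k })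
                (ordered? (suc k) (Fin.suc i) (Fin.suc j)) (ordered? k i j)))) ⟩
      ∑[ i < t ] ∑[ j < t ] (𝟙 (ordered? k i j) * (sz' i * sz' j))
    ≡⟨ pairSum≡∑∑ t sz' k ⟨
      pairSum t sz' k ∎

greedyEdges-closedForm : ∀ t (sz : Fin t → ℕ) (q : Fin t) {a} →
  prefixSum t sz (toℕ q) ≤ a → a < prefixSum t sz (toℕ q) + sz q →
  greedyEdges t sz a ≡ pairSum t sz (toℕ q) + (a ∸ prefixSum t sz (toℕ q)) * prefixSum t sz (toℕ q)
greedyEdges-closedForm (suc t) sz Fin.zero {a} _ a<n₁ = begin
    greedyEdges (suc t) sz a
  ≡⟨ a≤n₁⇒greedyEdges≡0 t sz (<⇒≤ (subst (λ p → a < p + sz Fin.zero) (prefixSum-zero (suc t) sz) a<n₁)) ⟩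
    0
  ≡⟨ *-zeroʳ a ⟨
    a * 0
  ≡⟨ cong₂ (λ s p → s + (a ∸ p) * p) (pairSum-zero (suc t) sz) (prefixSum-zero (suc t) sz) ⟨
    pairSum (suc t) sz 0 + (a ∸ prefixSum (suc t) sz 0) * prefixSum (suc t) sz 0 ∎
  where open ≡-Reasoning
greedyEdges-closedForm (suc t) sz (Fin.suc q) {a} P≤a a<P+n
  with m≤n⇒∃[o]m+o≡n (≤-trans (m≤m+n (sz Fin.zero) _) (subst (_≤ a) (prefixSum-suc t sz (toℕ q)) P≤a))
... | a' , refl = begin
    greedyEdges (suc t) sz (n₁ + a')
  ≡⟨ greedyEdges-+ t sz a' ⟩
    n₁ * a' + greedyEdges t sz' a'
  ≡⟨ cong (n₁ * a' +_) (greedyEdges-closedForm t sz' q P'≤a' a'<P'+n) ⟩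
    n₁ * a' + (S' + (a' ∸ P') * P')
  ≡⟨ cong (λ z → n₁ * z + (S' + (a' ∸ P') * P')) (m+[n∸m]≡n P'≤a') ⟨
    n₁ * (P' + (a' ∸ P')) + (S' + (a' ∸ P') * P')
  ≡⟨ rearrange n₁ P' (a' ∸ P') S' ⟩
    (n₁ * P' + S') + (a' ∸ P') * (n₁ + P')
  ≡⟨ cong (λ z → (n₁ * P' + S') + z * (n₁ + P')) ([m+n]∸[m+o]≡n∸o n₁ a' P') ⟨
    (n₁ * P' + S') + (n₁ + a' ∸ (n₁ + P')) * (n₁ + P')
  ≡⟨ cong₂ (λ s p → s + (n₁ + a' ∸ p) * p) (pairSum-suc t sz (toℕ q)) (prefixSum-suc t sz (toℕ q)) ⟨
    pairSum (suc t) sz (suc (toℕ q))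
      + (n₁ + a' ∸ prefixSum (suc t) sz (suc (toℕ q))) * prefixSum (suc t) sz (suc (toℕ q)) ∎
  where
  open ≡-Reasoning
  n₁  = sz Fin.zero
  sz' = sz ∘ Fin.suc
  P'  = prefixSum t sz' (toℕ q)
  S'  = pairSum t sz' (toℕ q)
  P'≤a' : P' ≤ a'
  P'≤a' = +-cancelˡ-≤ n₁ P' a' (subst (_≤ n₁ + a') (prefixSum-suc t sz (toℕ q)) P≤a)
  a'<P'+n : a' < P' + sz' q
  a'<P'+n = +-cancelˡ-< n₁ a' (P' + sz' q)
    (subst (n₁ + a' <_) (+-assoc n₁ P' (sz' q)) (subst (λ p → n₁ + a' < p + sz' q) (prefixSum-suc t sz (toℕ q)) a<P+n))
  rearrange : ∀ n₁ P' r S' → n₁ * (P' + r) + (S' + r * P') ≡ (n₁ * P' + S') + r * (n₁ + P')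
  rearrange = solve-∀

lemma5 : (t : ℕ) → 2 ≤ t → (sz : Fin t → ℕ)
       → (∀ (i j : Fin t) → toℕ i ≤ toℕ j → sz j ≤ sz i)
       → (∀ (i : Fin t) → 1 ≤ sz i)
       → (a : ℕ) → 0 < a → a < order t sz
       → (q : Fin t)
       → prefixSum t sz (toℕ q) ≤ a
       → a < prefixSum t sz (toℕ q) + sz q
       → let val = pairSum t sz (toℕ q)
                 + (a ∸ prefixSum t sz (toℕ q)) * prefixSum t sz (toℕ q)
         in (Σ (Subset (order t sz)) (λ A → ∣ A ∣ ≡ a × edgesIn t sz A ≡ val))
            × (∀ (A : Subset (order t sz)) → ∣ A ∣ ≡ a → val ≤ edgesIn t sz A)
lemma5 t _ sz antitone _ a _ a<n q P≤a a<P+n =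
    (greedySubset t sz a , ∣greedySubset∣ t sz a≤n , trans (edgesIn-greedySubset t sz a≤n) closedForm)
  , λ A ∣A∣≡a → subst (_≤ edgesIn t sz A) (trans (cong (greedyEdges t sz) ∣A∣≡a) closedForm)
                      (greedyEdges-≤-edgesIn t sz antitone A)
  where
  a≤n = <⇒≤ a<n
  closedForm = greedyEdges-closedForm t sz q P≤a a<P+n
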